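{- Let $h:\{0,1\}^n\to\{0,1\}$ satisfy $h(0^n)\ne h(1^n)$. Then for every $k\ge2$, $\mathsf{alt}(h^{\circ k})\ge\mathsf{alt}(h)^k$.
   Context: For $f$ on $m$ variables and $g$ on $n$ variables, $f\circ g$ on $mn$ variables is $(f\circ g)(x_{11},\dots,x_{mn})=f(g(x_{11},\dots,x_{1n}),\dots,g(x_{m1},\dots,x_{mn}))$. $h^{\circ 1}=h$ and $h^{\circ k}=h^{\circ(k-1)}\circ h$ for $k>1$ (a function on $n^k$ variables). $\mathsf{alt}$ is the maximum, over chains from the all-zeros to the all-ones input of distinct inputs increasing in the coordinatewise order, of the number of consecutive pairs on which the function value changes. -}

module Defs where

open import Data.Nat using (ℕ; zero; suc; _+_; _*_)
open import Data.Bool using (Bool; true; false; _xor_; if_then_else_) renaming (_≤_ to _≤B_)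
open import Data.Vec using (Vec; []; _∷_; take; drop; map; replicate; head)
open import Data.Vec.Relation.Binary.Pointwise.Inductive using (Pointwise)
open import Data.Product using (_×_; ∃)
open import Relation.Binary.PropositionalEquality using (_≡_; _≢_)

BoolFun : ℕ → Set
BoolFun N = Vec Bool N → Bool

blocks : (m n : ℕ) → Vec Bool (m * n) → Vec (Vec Bool n) m
blocks zero    n []  = []
blocks (suc m) n xs  = take n xs ∷ blocks m n (drop n xs)

_⊚_ : {m n : ℕ} → BoolFun m → BoolFun n → BoolFun (m * n)
_⊚_ {m} {n} f g xs = f (map g (blocks m n xs))

arity : ℕ → ℕ → ℕ
arity n zero    = 1
arity n (suc k) = arity n k * n

-- k-fold composition: iter h 0 is the identity on one variable (auxiliary),
-- iter h (suc k) = iter h k ∘ h, so iter h 1 = id ∘ h (= h) and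
-- iter h k = h^{∘k} for k ≥ 1, exactly as h^{∘k} = h^{∘(k-1)} ∘ h.
iter : {n : ℕ} → BoolFun n → (k : ℕ) → BoolFun (arity n k)
iter h zero    = head
iter h (suc k) = iter h k ⊚ h

_<ᵥ_ : {N : ℕ} → Vec Bool N → Vec Bool N → Set
x <ᵥ y = Pointwise _≤B_ x y × x ≢ y

data Chain {N : ℕ} : Vec Bool N → Vec Bool N → Set where
  done : {x : Vec Bool N} → Chain x x
  step : {x y z : Vec Bool N} → x <ᵥ y → Chain y z → Chain x z

changes : {N : ℕ} (f : BoolFun N) {x y : Vec Bool N} → Chain x y → ℕ
changes f done = 0
changes f (step {x} {y} _ c) = (if f x xor f y then 1 else 0) + changes f c

IsAlt : {N : ℕ} → BoolFun N → ℕ → Set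
IsAlt {N} f a =
  ∃ (λ (c : Chain (replicate N false) (replicate N true)) → changes f c ≡ a)
  × ((c : Chain (replicate N false) (replicate N true)) → changes f c Data.Nat.≤ a)

module Submission where

-- Say that f "reaches r" if some monotone walk from 0…0 to 1…1, whose
-- consecutive points may coincide, changes the value of f at least r times.
-- Repeated points change nothing, so they can be dropped: a function reaching
-- r has alt ≥ r.  The heart of the proof is a composition bound:
--
--   if g(0ⁿ) ≠ g(1ⁿ), f reaches r and g reaches a, then f ∘ g reaches a·r.
--
-- When g(0ⁿ) = 0, g(1ⁿ) = 1 the walk for f ∘ g is obtained by blowing up each
-- step s ≤ s' of the walk for f: the blocks where s is 1 are held at 1ⁿ,
-- those where s' is 0 at 0ⁿ, and the blocks that switch from 0 to 1 all move
-- together along the walk for g.  On this piece f ∘ g takes only the values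
-- f(s) and f(s'), switching exactly when g does, so it contributes
-- a · [f(s) ≠ f(s')] changes.  The case g(0ⁿ) = 1 reduces to this one via
-- f ∘ g = (f ∘ ¬) ∘ (¬ ∘ g), since a walk for f ∘ ¬ is the complemented,
-- reversed walk for f.  Iterating the bound gives that h^{∘k} reaches alt(h)^k
-- (for every k, in fact), which is the corollary.

open import Defs
open import Data.Nat using (ℕ; zero; suc; _+_; _*_; _^_; _≤_; z≤n)
open import Data.Nat.Properties
  using (+-assoc; +-comm; +-identityʳ; *-identityˡ; *-zeroʳ; *-distribˡ-+; *-distribʳ-+;
         *-mono-≤; +-monoʳ-≤; ≤-refl; ≤-reflexive; ≤-trans)
open import Data.Bool using (Bool; true; false; not; _xor_; if_then_else_; f≤t; b≤b)
  renaming (_≤_ to _≤B_)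
open import Data.Bool.Properties using (not-involutive; xor-annihilates-not; if-float; if-eta)
  renaming (_≟_ to _≟B_)
open import Data.Vec using (Vec; []; _∷_; replicate; map; take; drop; concat; _++_)
open import Data.Vec.Properties
  using (map-replicate; map-∘; map-cong; map-id; ≡-dec; take++drop≡id; ++-injectiveˡ; ++-injectiveʳ)
open import Data.Vec.Relation.Binary.Pointwise.Inductive using (Pointwise; []; _∷_; concat⁺)
  renaming (refl to pointwise-refl)
open import Data.Product using (Σ; _,_; proj₁; proj₂)
open import Data.Empty using (⊥-elim)
open import Function using (_∘_)
open import Relation.Binary.PropositionalEquality
open import Relation.Nullary using (yes; no)

_≤ᵛ_ : {N : ℕ} → Vec Bool N → Vec Bool N → Set
x ≤ᵛ y = Pointwise _≤B_ x y

≤ᵛ-refl : {N : ℕ} {x : Vec Bool N} → x ≤ᵛ x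
≤ᵛ-refl = pointwise-refl b≤b

data Walk {N : ℕ} : Vec Bool N → Vec Bool N → Set where
  here : {x : Vec Bool N} → Walk x x
  step : {x y z : Vec Bool N} → x ≤ᵛ y → Walk y z → Walk x z

-- [u ≠ v] as a number; literally the summand used by 'changes'.
differs : Bool → Bool → ℕ
differs u v = if u xor v then 1 else 0

differs-same : ∀ u → differs u u ≡ 0
differs-same true  = refl
differs-same false = refl

differs-comm : ∀ u v → differs u v ≡ differs v u
differs-comm true  true  = refl
differs-comm true  false = refl
differs-comm false true  = refl
differs-comm false false = refl

flips : {N : ℕ} (f : BoolFun N) {x y : Vec Bool N} → Walk x y → ℕ
flips f here = 0
flips f (step {x} {y} _ w) = differs (f x) (f y) + flips f w

flips-cong : {N : ℕ} {f g : BoolFun N} → (∀ z → f z ≡ g z) →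
  {x y : Vec Bool N} (w : Walk x y) → flips f w ≡ flips g w
flips-cong e here = refl
flips-cong e (step {x} {y} _ w) = cong₂ _+_ (cong₂ differs (e x) (e y)) (flips-cong e w)

_++ʷ_ : {N : ℕ} {x y z : Vec Bool N} → Walk x y → Walk y z → Walk x z
here       ++ʷ v = v
step p w   ++ʷ v = step p (w ++ʷ v)

flips-++ : {N : ℕ} (f : BoolFun N) {x y z : Vec Bool N} (w : Walk x y) (v : Walk y z) →
  flips f (w ++ʷ v) ≡ flips f w + flips f v
flips-++ f here v = refl
flips-++ f (step {x} {y} _ w) v =
  trans (cong (differs (f x) (f y) +_) (flips-++ f w v))
        (sym (+-assoc (differs (f x) (f y)) (flips f w) (flips f v)))

mapWalk : {N M : ℕ} (L : Vec Bool N → Vec Bool M) → (∀ {x y} → x ≤ᵛ y → L x ≤ᵛ L y) →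
  {x y : Vec Bool N} → Walk x y → Walk (L x) (L y)
mapWalk L mono here       = here
mapWalk L mono (step p w) = step (mono p) (mapWalk L mono w)

flips-mapWalk : {N M : ℕ} (f : BoolFun M) (L : Vec Bool N → Vec Bool M)
  (mono : ∀ {x y} → x ≤ᵛ y → L x ≤ᵛ L y) {x y : Vec Bool N} (w : Walk x y) →
  flips f (mapWalk L mono w) ≡ flips (f ∘ L) w
flips-mapWalk f L mono here = refl
flips-mapWalk f L mono (step {x} {y} _ w) = cong (differs (f (L x)) (f (L y)) +_) (flips-mapWalk f L mono w)

relabel : {N : ℕ} {x x' y y' : Vec Bool N} → x' ≡ x → y ≡ y' → Walk x y → Walk x' y'
relabel refl refl w = w

flips-relabel : {N : ℕ} (f : BoolFun N) {x x' y y' : Vec Bool N} (p : x' ≡ x) (q : y ≡ y')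
  (w : Walk x y) → flips f (relabel p q w) ≡ flips f w
flips-relabel f refl refl w = refl

weaken : {N : ℕ} {x y : Vec Bool N} → Chain x y → Walk x y
weaken done       = here
weaken (step p c) = step (proj₁ p) (weaken c)

flips-weaken : {N : ℕ} (f : BoolFun N) {x y : Vec Bool N} (c : Chain x y) →
  flips f (weaken c) ≡ changes f c
flips-weaken f done = refl
flips-weaken f (step {x} {y} _ c) = cong (differs (f x) (f y) +_) (flips-weaken f c)

strengthen : {N : ℕ} (f : BoolFun N) {x y : Vec Bool N} (w : Walk x y) →
  Σ (Chain x y) (λ c → flips f w ≤ changes f c)
strengthen f here = done , z≤n
strengthen f (step {x} {y} p w) with ≡-dec _≟B_ x y | strengthen f w
... | yes refl | c , bound = c , subst (λ d → d + flips f w ≤ changes f c) (sym (differs-same (f x))) bound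
... | no  x≢y  | c , bound = step (p , x≢y) c , +-monoʳ-≤ (differs (f x) (f y)) bound

Reaches : {N : ℕ} → BoolFun N → ℕ → Set
Reaches {N} f r = Σ (Walk (replicate N false) (replicate N true)) (λ w → r ≤ flips f w)

reaches-cong : {N : ℕ} {f g : BoolFun N} {r : ℕ} → (∀ z → f z ≡ g z) → Reaches f r → Reaches g r
reaches-cong e (w , bound) = w , subst (_ ≤_) (flips-cong e w) bound

reaches-not : {N : ℕ} {g : BoolFun N} {r : ℕ} → Reaches g r → Reaches (not ∘ g) r
reaches-not {g = g} (w , bound) = w , subst (_ ≤_) (sym (flips-not w)) bound
  where
    flips-not : {x y : Vec Bool _} (v : Walk x y) → flips (not ∘ g) v ≡ flips g v
    flips-not here = refl
    flips-not (step {x} {y} _ v) =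
      cong₂ _+_ (cong (λ b → if b then 1 else 0) (xor-annihilates-not (g x) (g y))) (flips-not v)

negV : {N : ℕ} → Vec Bool N → Vec Bool N
negV = map not

negV-involutive : {N : ℕ} (x : Vec Bool N) → negV (negV x) ≡ x
negV-involutive x = trans (sym (map-∘ not not x)) (trans (map-cong not-involutive x) (map-id x))

negV-antitone : {N : ℕ} {x y : Vec Bool N} → x ≤ᵛ y → negV y ≤ᵛ negV x
negV-antitone [] = []
negV-antitone (f≤t ∷ p) = f≤t ∷ negV-antitone p
negV-antitone (b≤b ∷ p) = b≤b ∷ negV-antitone p

reverse : {N : ℕ} {x y : Vec Bool N} → Walk x y → Walk (negV y) (negV x)
reverse here       = here
reverse (step p w) = reverse w ++ʷ step (negV-antitone p) here

flips-reverse : {N : ℕ} (φ : BoolFun N) {x y : Vec Bool N} (w : Walk x y) →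
  flips φ (reverse w) ≡ flips (φ ∘ negV) w
flips-reverse φ here = refl
flips-reverse φ (step {x} {y} p w) = begin
  flips φ (reverse w ++ʷ step (negV-antitone p) here)  ≡⟨ flips-++ φ (reverse w) _ ⟩
  flips φ (reverse w) + (d' + 0)                        ≡⟨ cong₂ _+_ (flips-reverse φ w) (+-identityʳ d') ⟩
  flips (φ ∘ negV) w + d'                               ≡⟨ +-comm _ d' ⟩
  d' + flips (φ ∘ negV) w                               ≡⟨ cong (_+ flips (φ ∘ negV) w) (differs-comm (φ (negV y)) (φ (negV x))) ⟩
  differs (φ (negV x)) (φ (negV y)) + flips (φ ∘ negV) w ∎
  where
    open ≡-Reasoning
    d' = differs (φ (negV y)) (φ (negV x))

reaches-complement : {N : ℕ} {f : BoolFun N} {r : ℕ} → Reaches f r → Reaches (f ∘ negV) r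
reaches-complement {N} {f} (w , bound) =
  relabel (sym (negV-rep true)) (negV-rep false) (reverse w) ,
  subst (_ ≤_) (sym same) bound
  where
    negV-rep : (b : Bool) → negV (replicate N b) ≡ replicate N (not b)
    negV-rep b = map-replicate not b N
    same : flips (f ∘ negV) (relabel (sym (negV-rep true)) (negV-rep false) (reverse w)) ≡ flips f w
    same = trans (flips-relabel (f ∘ negV) (sym (negV-rep true)) (negV-rep false) (reverse w))
             (trans (flips-reverse (f ∘ negV) w) (flips-cong (cong f ∘ negV-involutive) w))

differs-select : (c d u v : Bool) →
  differs (if c then v else u) (if d then v else u) ≡ differs c d * differs u v
differs-select false false u v = differs-same u
differs-select true  true  u v = differs-same v
differs-select false true  u v = sym (*-identityˡ _)
differs-select true  false u v = trans (differs-comm v u) (sym (*-identityˡ _))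

flips-select : {N : ℕ} (G : BoolFun N) (u v : Bool) {x y : Vec Bool N} (w : Walk x y) →
  flips (λ p → if G p then v else u) w ≡ flips G w * differs u v
flips-select G u v here = refl
flips-select G u v (step {x} {y} _ w) =
  trans (cong₂ _+_ (differs-select (G x) (G y) u v) (flips-select G u v w))
        (sym (*-distribʳ-+ (differs u v) (differs (G x) (G y)) (flips G w)))

replicate-+ : (j l : ℕ) (b : Bool) → replicate (j + l) b ≡ replicate j b ++ replicate l b
replicate-+ zero    l b = refl
replicate-+ (suc j) l b = cong (b ∷_) (replicate-+ j l b)

module Blocks (n : ℕ) where

  rep : Bool → Vec Bool n
  rep b = replicate n b

  blocks-concat : (m : ℕ) (bs : Vec (Vec Bool n) m) → blocks m n (concat bs) ≡ bs
  blocks-concat zero    []       = refl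
  blocks-concat (suc m) (b ∷ bs) = cong₂ _∷_ take-b (trans (cong (blocks m n) drop-b) (blocks-concat m bs))
    where
      split : take n (b ++ concat bs) ++ drop n (b ++ concat bs) ≡ b ++ concat bs
      split = take++drop≡id n (b ++ concat bs)
      take-b : take n (b ++ concat bs) ≡ b
      take-b = ++-injectiveˡ (take n (b ++ concat bs)) b split
      drop-b : drop n (b ++ concat bs) ≡ concat bs
      drop-b = ++-injectiveʳ (take n (b ++ concat bs)) b split

  composed-concat : {m : ℕ} (f : BoolFun m) (g : BoolFun n) (bs : Vec (Vec Bool n) m) →
    (f ⊚ g) (concat bs) ≡ f (map g bs)
  composed-concat {m} f g bs = cong (f ∘ map g) (blocks-concat m bs)

  embed : {m : ℕ} → Vec Bool m → Vec Bool (m * n)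
  embed s = concat (map rep s)

  embed-rep : (m : ℕ) (b : Bool) → embed (replicate m b) ≡ replicate (m * n) b
  embed-rep m b = trans (cong concat (map-replicate rep b m)) (concat-rep m)
    where
      concat-rep : (j : ℕ) → concat (replicate j (rep b)) ≡ replicate (j * n) b
      concat-rep zero    = refl
      concat-rep (suc j) = trans (cong (rep b ++_) (concat-rep j)) (sym (replicate-+ n (j * n) b))

  -- The block configuration on the step from s to s': blocks with sᵢ = 1
  -- stay at 1ⁿ, blocks with s'ᵢ = 0 stay at 0ⁿ, the others equal p.
  block : Bool → Bool → Vec Bool n → Vec Bool n
  block a b p = if a then rep true else (if b then p else rep false)

  mix : {m : ℕ} → Vec Bool m → Vec Bool m → Vec Bool n → Vec (Vec Bool n) m
  mix []      []       p = []
  mix (a ∷ s) (b ∷ s') p = block a b p ∷ mix s s' p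

  mix-mono : {m : ℕ} (s s' : Vec Bool m) {p q : Vec Bool n} → p ≤ᵛ q →
    Pointwise _≤ᵛ_ (mix s s' p) (mix s s' q)
  mix-mono []          []           p≤q = []
  mix-mono (true ∷ s)  (_ ∷ s')     p≤q = ≤ᵛ-refl ∷ mix-mono s s' p≤q
  mix-mono (false ∷ s) (true ∷ s')  p≤q = p≤q ∷ mix-mono s s' p≤q
  mix-mono (false ∷ s) (false ∷ s') p≤q = ≤ᵛ-refl ∷ mix-mono s s' p≤q

  mix-bottom : {m : ℕ} (s s' : Vec Bool m) → mix s s' (rep false) ≡ map rep s
  mix-bottom []          []       = refl
  mix-bottom (true ∷ s)  (_ ∷ s') = cong (rep true ∷_) (mix-bottom s s')
  mix-bottom (false ∷ s) (b ∷ s') = cong₂ _∷_ (if-eta b) (mix-bottom s s')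

  mix-top : {m : ℕ} {s s' : Vec Bool m} → s ≤ᵛ s' → mix s s' (rep true) ≡ map rep s'
  mix-top [] = refl
  mix-top {s = false ∷ _} (f≤t ∷ le) = cong (rep true ∷_) (mix-top le)
  mix-top {s = true ∷ _}  (b≤b ∷ le) = cong (rep true ∷_) (mix-top le)
  mix-top {s = false ∷ _} (b≤b ∷ le) = cong (rep false ∷_) (mix-top le)

  module Normal (g : BoolFun n) (g-bottom : g (rep false) ≡ false) (g-top : g (rep true) ≡ true) where

    block-value : {a b : Bool} (p : Vec Bool n) → a ≤B b → g (block a b p) ≡ (if g p then b else a)
    block-value p f≤t with g p
    ... | true  = refl
    ... | false = refl
    block-value {true}  p b≤b = trans g-top (sym (if-eta (g p)))
    block-value {false} p b≤b = trans g-bottom (sym (if-eta (g p)))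

    mix-value : {m : ℕ} {s s' : Vec Bool m} (p : Vec Bool n) → s ≤ᵛ s' →
      map g (mix s s' p) ≡ (if g p then s' else s)
    mix-value p [] = sym (if-eta (g p))
    mix-value {s = a ∷ s} {b ∷ s'} p (a≤b ∷ le) =
      trans (cong₂ _∷_ (block-value p a≤b) (mix-value p le)) (if-∷ (g p))
      where
        if-∷ : ∀ c → (if c then b else a) ∷ (if c then s' else s) ≡ (if c then b ∷ s' else a ∷ s)
        if-∷ true  = refl
        if-∷ false = refl

    module Lift {m : ℕ} (f : BoolFun m) (wg : Walk (rep false) (rep true)) where

      moving : (s s' : Vec Bool m) → Walk (concat (mix s s' (rep false))) (concat (mix s s' (rep true)))
      moving s s' = mapWalk (concat ∘ mix s s') (concat⁺ ∘ mix-mono s s') wg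

      liftStep : {s s' : Vec Bool m} → s ≤ᵛ s' → Walk (embed s) (embed s')
      liftStep {s} {s'} le = relabel (cong concat (sym (mix-bottom s s'))) (cong concat (mix-top le)) (moving s s')

      flips-liftStep : {s s' : Vec Bool m} (le : s ≤ᵛ s') →
        flips (f ⊚ g) (liftStep le) ≡ flips g wg * differs (f s) (f s')
      flips-liftStep {s} {s'} le = begin
        flips (f ⊚ g) (liftStep le)
          ≡⟨ flips-relabel (f ⊚ g) (cong concat (sym (mix-bottom s s'))) (cong concat (mix-top le)) (moving s s') ⟩
        flips (f ⊚ g) (moving s s')
          ≡⟨ flips-mapWalk (f ⊚ g) (concat ∘ mix s s') (concat⁺ ∘ mix-mono s s') wg ⟩
        flips ((f ⊚ g) ∘ concat ∘ mix s s') wg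
          ≡⟨ flips-cong two-valued wg ⟩
        flips (λ p → if g p then f s' else f s) wg
          ≡⟨ flips-select g (f s) (f s') wg ⟩
        flips g wg * differs (f s) (f s') ∎
        where
          open ≡-Reasoning
          two-valued : ∀ p → (f ⊚ g) (concat (mix s s' p)) ≡ (if g p then f s' else f s)
          two-valued p = trans (composed-concat f g (mix s s' p))
                               (trans (cong f (mix-value p le)) (if-float f (g p)))

      lift : {s t : Vec Bool m} → Walk s t → Walk (embed s) (embed t)
      lift here        = here
      lift (step le w) = liftStep le ++ʷ lift w

      flips-lift : {s t : Vec Bool m} (w : Walk s t) → flips (f ⊚ g) (lift w) ≡ flips g wg * flips f w
      flips-lift here = sym (*-zeroʳ (flips g wg))
      flips-lift (step {x} {y} le w) =
        trans (flips-++ (f ⊚ g) (liftStep le) (lift w))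
          (trans (cong₂ _+_ (flips-liftStep le) (flips-lift w))
            (sym (*-distribˡ-+ (flips g wg) (differs (f x) (f y)) (flips f w))))

    reaches-compose-normal : {m : ℕ} {f : BoolFun m} {r a : ℕ} →
      Reaches f r → Reaches g a → Reaches (f ⊚ g) (a * r)
    reaches-compose-normal {m} {f} (w , r≤) (wg , a≤) =
      relabel from-bottom to-top (lift w) ,
      subst (_ ≤_) (sym (trans (flips-relabel (f ⊚ g) from-bottom to-top (lift w)) (flips-lift w))) (*-mono-≤ a≤ r≤)
      where
        open Lift f wg
        from-bottom : replicate (m * n) false ≡ embed (replicate m false)
        from-bottom = sym (embed-rep m false)
        to-top : embed (replicate m true) ≡ replicate (m * n) true
        to-top = embed-rep m true

  -- The composition bound, in general: reduce g(0ⁿ) = 1 to the normal case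
  -- through f ∘ g = (f ∘ ¬) ∘ (¬ ∘ g).
  reaches-compose : {m : ℕ} {f : BoolFun m} {g : BoolFun n} {r a : ℕ} →
    g (rep false) ≢ g (rep true) → Reaches f r → Reaches g a → Reaches (f ⊚ g) (a * r)
  reaches-compose {f = f} {g} g0≢g1 rf rg with g (rep false) in e0 | g (rep true) in e1
  ... | false | true  = Normal.reaches-compose-normal g e0 e1 rf rg
  ... | true  | false = reaches-cong double-negation
        (Normal.reaches-compose-normal (not ∘ g) (cong not e0) (cong not e1) (reaches-complement rf) (reaches-not rg))
    where
      double-negation : ∀ x → ((f ∘ negV) ⊚ (not ∘ g)) x ≡ (f ⊚ g) x
      double-negation x = cong f (trans (sym (map-∘ not (not ∘ g) _)) (map-cong (not-involutive ∘ g) _))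
  ... | false | false = ⊥-elim (g0≢g1 refl)
  ... | true  | true  = ⊥-elim (g0≢g1 refl)

reaches-iter : {n : ℕ} {h : BoolFun n} {a : ℕ} → h (replicate n false) ≢ h (replicate n true) →
  Reaches h a → (j : ℕ) → Reaches (iter h j) (a ^ j)
reaches-iter h0≢h1 rh zero    = step (f≤t ∷ []) here , ≤-refl
reaches-iter {n} h0≢h1 rh (suc j) = Blocks.reaches-compose n h0≢h1 (reaches-iter h0≢h1 rh j) rh

corollary10 : (n : ℕ) (h : BoolFun n) →
    h (replicate n false) ≢ h (replicate n true) →
    (k : ℕ) → 2 ≤ k → (a b : ℕ) → IsAlt h a → IsAlt (iter h k) b →
    a ^ k ≤ b
corollary10 n h h0≢h1 k _ a b ((c , changes≡a) , _) (_ , maximal) =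
  ≤-trans (proj₂ iterated) (≤-trans (proj₂ dense) (maximal (proj₁ dense)))
  where
    h-reaches-a : Reaches h a
    h-reaches-a = weaken c , ≤-reflexive (sym (trans (flips-weaken h c) changes≡a))
    iterated : Reaches (iter h k) (a ^ k)
    iterated = reaches-iter h0≢h1 h-reaches-a k
    dense : Σ (Chain _ _) (λ chain → flips (iter h k) (proj₁ iterated) ≤ changes (iter h k) chain)
    dense = strengthen (iter h k) (proj₁ iterated)
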